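{- Let $H$ be a graph with at least two vertices and let $G=H[G_v : v\in V(H)]$ be an inflation of $H$ by nonempty graphs $G_v$. Then either there is a vertex $x\in V(H)$ with $\operatorname{lcw}(G_x)=\operatorname{lcw}(G)$, or there are distinct vertices $x,y\in V(H)$ with $\operatorname{lcw}(G_x)\ge \operatorname{lcw}(G)-\operatorname{lcw}(H)-1$ and $\operatorname{lcw}(G_y)\ge\operatorname{lcw}(G)-\operatorname{lcw}(H)-1$.
   Context: The linear clique-width $\operatorname{lcw}(G)$ of a graph $G$ is the smallest number of labels needed to construct $G$ by a sequence of the operations: (1) introduce a new vertex with some label; (2) for labels $i\neq j$, add edges between all vertices labeled $i$ and all vertices labeled $j$; (3) for labels $i\ne j$, relabel all vertices labeled $i$ to $j$. Given a graph $H$ and nonempty graphs $G_v$ ($v\in V(H)$), the inflation $H[G_v : v\in V(H)]$ is the graph obtained by replacing each vertex $v$ of $H$ by a copy of $G_v$, where for distinct $u,v$ every vertex of $G_u$ is adjacent to every vertex of $G_v$ if $uv\in E(H)$ and to none of them otherwise. -}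

module Defs where

open import Data.Nat using (ℕ; zero; suc; _≤_)
open import Data.Fin using (Fin; zero; suc; _≟_)
open import Data.Bool using (Bool; true; false; _∨_; _∧_; if_then_else_)
open import Data.List using (List; foldl)
open import Data.Product using (Σ; _×_; _,_; proj₁; proj₂)
open import Relation.Nullary using (¬_; yes; no)
open import Relation.Nullary.Decidable using (⌊_⌋)
open import Relation.Binary.PropositionalEquality using (_≡_; refl)
open import Function.Bundles using (_↔_; Inverse)

record Graph : Set where
  field
    n      : ℕ
    Adj    : Fin n → Fin n → Bool
    sym    : ∀ u v → Adj u v ≡ Adj v u
    irrefl : ∀ u → Adj u u ≡ false
open Graph public


data Op (k : ℕ) : Set where
  intro   : Fin k → Op k
  join    : (i j : Fin k) → ¬ (i ≡ j) → Op k
  relabel : (i j : Fin k) → ¬ (i ≡ j) → Op k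

record LGraph (k : ℕ) : Set where
  field
    m     : ℕ
    label : Fin m → Fin k
    adj   : Fin m → Fin m → Bool
open LGraph public

emptyLG : ∀ {k} → LGraph k
emptyLG = record { m = 0 ; label = λ () ; adj = λ () }

_==_ : ∀ {k} → Fin k → Fin k → Bool
a == b = ⌊ a ≟ b ⌋

step : ∀ {k} → LGraph k → Op k → LGraph k
step s (intro c) = record { m = suc (m s) ; label = lab ; adj = ad }
  where
  lab : Fin (suc (m s)) → _
  lab zero    = c
  lab (suc v) = label s v
  ad : Fin (suc (m s)) → Fin (suc (m s)) → Bool
  ad zero    _       = false
  ad (suc u) zero    = false
  ad (suc u) (suc v) = adj s u v
step s (join i j _) = record
  { m = m s ; label = label s
  ; adj = λ u v → adj s u v ∨ ((label s u == i ∧ label s v == j) ∨ (label s u == j ∧ label s v == i)) }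
step s (relabel i j _) = record
  { m = m s ; label = λ u → if label s u == i then j else label s u ; adj = adj s }

run : ∀ {k} → List (Op k) → LGraph k
run ops = foldl step emptyLG ops

IsoTo : ∀ {k} → LGraph k → Graph → Set
IsoTo s G = Σ (Fin (m s) ↔ Fin (n G)) λ φ →
  ∀ u v → adj s u v ≡ Adj G (Inverse.to φ u) (Inverse.to φ v)

LinConstructible : ℕ → Graph → Set
LinConstructible k G = Σ (List (Op k)) λ ops → IsoTo (run ops) G

Lcw : Graph → ℕ → Set
Lcw G k = LinConstructible k G × (∀ j → LinConstructible j G → k ≤ j)

inflAdj : (H : Graph) (Gs : Fin (n H) → Graph) →
          Σ (Fin (n H)) (λ v → Fin (n (Gs v))) →
          Σ (Fin (n H)) (λ v → Fin (n (Gs v))) → Bool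
inflAdj H Gs (v , a) (w , b) with v ≟ w
... | yes refl = Adj (Gs v) a b
... | no _     = Adj H v w

IsInflation : (G H : Graph) (Gs : Fin (n H) → Graph) → Set
IsInflation G H Gs =
  Σ (Fin (n G) ↔ Σ (Fin (n H)) (λ v → Fin (n (Gs v)))) λ φ →
    ∀ a b → Adj G a b ≡ inflAdj H Gs (Inverse.to φ a) (Inverse.to φ b)

{-# OPTIONS --safe #-}
-- Each part G_x is an induced subgraph of G, so lcw(G_x) ≤ lcw(G): keep only the introductions
-- of its vertices in an expression for G. In the other direction, fix x and M ≥ lcw(G_v) for
-- all v ≠ x; then G has a linear expression with K = 1 + lcw(H) + M labels, provided
-- lcw(G_x) ≤ K. Build G_x first, using all K labels, and park it under one label; then follow
-- an expression for H on lcw(H) other labels, replacing the introduction of a vertex v ≠ x by a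
-- construction of G_v on the M remaining labels followed by relabelling them all to the label
-- of v, and the introduction of x by relabelling the parked copy. Hence if no part attains
-- lcw(G), every x has a partner y ≠ x with lcw(G) ≤ lcw(G_y) + lcw(H) + 1, and two successive
-- partners are the pair sought.
module Submission where

open import Defs hiding (sym)
open import Level using (0ℓ) renaming (suc to lsuc)
open import Axiom.UniquenessOfIdentityProofs using (module Decidable⇒UIP)
open import Data.Bool using (Bool; true; false; _∨_; _∧_; if_then_else_; T)
open import Data.Bool.Properties using (∨-identityʳ; ∧-zeroʳ; T-irrelevant)
open import Data.Empty using (⊥; ⊥-elim)
open import Data.Fin using (Fin; zero; suc; _≟_; inject≤; _↑ˡ_; _↑ʳ_; splitAt; fromℕ<; punchIn)
open import Data.Fin.Properties
  using (inject≤-injective; suc-injective; ↑ˡ-injective; ↑ʳ-injective; splitAt-↑ˡ; splitAt-↑ʳ;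
         punchInᵢ≢i; any?; all?)
open import Data.List using (List; []; _∷_; _++_; map; foldr; reverse; allFin)
open import Data.List.Properties using (reverse-foldr; reverse-involutive; foldr-++)
open import Data.List.Membership.Propositional using (_∈_)
open import Data.List.Membership.Propositional.Properties using (∈-allFin; ∈-map⁺; ∈-map⁻)
open import Data.List.Relation.Unary.Any using (here; there)
open import Data.Nat using (ℕ; zero; suc; _≤_; _<_; _+_; _∸_; s≤s; s≤s⁻¹; _≤?_)
  renaming (_≟_ to _≟ₙ_)
open import Data.Nat.Properties
  using (≤-antisym; ≮⇒≥; ≰⇒>; n≮0; 1+n≰n; +-comm; +-suc; m+n≤o⇒m≤o∸n; m+n≤o⇒n≤o;
         m+[n∸m]≡n)
open import Data.Product using (Σ; _×_; _,_; proj₁; proj₂)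
open import Data.Product.Function.Dependent.Propositional using (Σ-↔)
open import Data.Product.Properties using (,-injectiveʳ-UIP)
open import Data.Sum using (_⊎_; inj₁; inj₂; [_,_])
open import Data.Sum.Algebra using (⊎-comm; ⊎-assoc)
open import Data.Sum.Function.Propositional using (_⊎-↔_)
open import Data.Unit using (⊤; tt)
open import Function using (_∘_; id; const)
open import Function.Bundles using (_↔_; Inverse; Injection; mk↔ₛ′; mk⇔)
open import Function.Definitions using (Injective)
open import Function.Properties.Inverse using (↔-refl; ↔-sym; ↔-trans; ↔⇒↣)
open import Relation.Binary.Bundles using (Setoid)
open import Relation.Binary.PropositionalEquality
  using (_≡_; refl; sym; trans; cong; cong₂; subst; module ≡-Reasoning)
open import Relation.Nullary using (¬_; yes; no; Dec; ¬?)
open import Relation.Nullary.Decidable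
  using (_×-dec_; ⌊_⌋; toWitness; fromWitness; isYes≗does; does-⇔)

open Inverse using (to; from; strictlyInverseˡ; strictlyInverseʳ)

private variable k k′ : ℕ

-- Labelled graphs up to isomorphism

-- Vertex sets are arbitrary types, so that disjoint unions and inflations are sums and
-- Σ-types on the nose; a construction state is compared with them only up to isomorphism.
record LabelledGraph (k : ℕ) : Set₁ where
  constructor labelled
  field
    Vertex  : Set
    labelOf : Vertex → Fin k
    edge    : Vertex → Vertex → Bool
open LabelledGraph

record _≅_ (X Y : LabelledGraph k) : Set where
  constructor mk≅
  field
    bijection  : Vertex X ↔ Vertex Y
    labelOf-to : ∀ a → labelOf Y (to bijection a) ≡ labelOf X a
    edge-to    : ∀ a b → edge Y (to bijection a) (to bijection b) ≡ edge X a b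

infix 4 _≅_

≅-refl : {X : LabelledGraph k} → X ≅ X
≅-refl = mk≅ ↔-refl (λ _ → refl) (λ _ _ → refl)

≅-reflexive : {X Y : LabelledGraph k} → X ≡ Y → X ≅ Y
≅-reflexive refl = ≅-refl

≅-sym : {X Y : LabelledGraph k} → X ≅ Y → Y ≅ X
≅-sym {X = X} {Y} (mk≅ φ lab-φ edge-φ) = mk≅ (↔-sym φ)
  (λ b → trans (sym (lab-φ (from φ b))) (cong (labelOf Y) (strictlyInverseˡ φ b)))
  (λ b b′ → trans (sym (edge-φ (from φ b) (from φ b′)))
                  (cong₂ (edge Y) (strictlyInverseˡ φ b) (strictlyInverseˡ φ b′)))

≅-trans : {X Y Z : LabelledGraph k} → X ≅ Y → Y ≅ Z → X ≅ Z
≅-trans (mk≅ φ lab-φ edge-φ) (mk≅ χ lab-χ edge-χ) = mk≅ (↔-trans φ χ)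
  (λ a → trans (lab-χ (to φ a)) (lab-φ a))
  (λ a b → trans (edge-χ (to φ a) (to φ b)) (edge-φ a b))

≅-setoid : ℕ → Setoid (lsuc 0ℓ) 0ℓ
≅-setoid k = record
  { Carrier = LabelledGraph k
  ; _≈_ = _≅_
  ; isEquivalence = record { refl = ≅-refl ; sym = ≅-sym ; trans = ≅-trans }
  }

module ≅-Reasoning {k : ℕ} where
  open import Relation.Binary.Reasoning.Setoid (≅-setoid k) public

≅-pointwise : {V : Set} {l l′ : V → Fin k} {e e′ : V → V → Bool} →
              (∀ a → l′ a ≡ l a) → (∀ a b → e′ a b ≡ e a b) →
              labelled V l e ≅ labelled V l′ e′
≅-pointwise = mk≅ ↔-refl

⟦_⟧ : LGraph k → LabelledGraph k
⟦ s ⟧ = labelled (Fin (m s)) (label s) (adj s)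

vertexᴸ : Fin k → LabelledGraph k
vertexᴸ c = labelled ⊤ (const c) (λ _ _ → false)

sumEdge : {A B : Set} → (A → A → Bool) → (B → B → Bool) → A ⊎ B → A ⊎ B → Bool
sumEdge e e′ (inj₁ a) (inj₁ b) = e a b
sumEdge e e′ (inj₂ a) (inj₂ b) = e′ a b
sumEdge e e′ (inj₁ _) (inj₂ _) = false
sumEdge e e′ (inj₂ _) (inj₁ _) = false

infixr 6 _⊕_

_⊕_ : LabelledGraph k → LabelledGraph k → LabelledGraph k
X ⊕ Y = labelled (Vertex X ⊎ Vertex Y) [ labelOf X , labelOf Y ] (sumEdge (edge X) (edge Y))

mapLabels : (Fin k → Fin k′) → LabelledGraph k → LabelledGraph k′
mapLabels f X = labelled (Vertex X) (f ∘ labelOf X) (edge X)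

monochrome : Fin k → Graph → LabelledGraph k
monochrome c G = labelled (Fin (n G)) (const c) (Adj G)

joinᴸ : Fin k → Fin k → LabelledGraph k → LabelledGraph k
joinᴸ i j X = labelled (Vertex X) (labelOf X) λ a b →
  edge X a b ∨ ((labelOf X a == i ∧ labelOf X b == j) ∨ (labelOf X a == j ∧ labelOf X b == i))

relabelLabel : Fin k → Fin k → Fin k → Fin k
relabelLabel i j l = if l == i then j else l

stepᴸ : LabelledGraph k → Op k → LabelledGraph k
stepᴸ X (intro c)       = vertexᴸ c ⊕ X
stepᴸ X (join i j _)    = joinᴸ i j X
stepᴸ X (relabel i j _) = mapLabels (relabelLabel i j) X

⟦step⟧ : (s : LGraph k) (o : Op k) → ⟦ step s o ⟧ ≅ stepᴸ ⟦ s ⟧ o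
⟦step⟧ s (intro c) = mk≅ (mk↔ₛ′ split unsplit split-unsplit unsplit-split) lab-split edge-split
  where
  split : Fin (suc (m s)) → ⊤ ⊎ Fin (m s)
  split zero    = inj₁ tt
  split (suc u) = inj₂ u
  unsplit : ⊤ ⊎ Fin (m s) → Fin (suc (m s))
  unsplit = [ const zero , suc ]
  split-unsplit : ∀ a → split (unsplit a) ≡ a
  split-unsplit (inj₁ tt) = refl
  split-unsplit (inj₂ u)  = refl
  unsplit-split : ∀ u → unsplit (split u) ≡ u
  unsplit-split zero    = refl
  unsplit-split (suc u) = refl
  lab-split : ∀ u → labelOf (vertexᴸ c ⊕ ⟦ s ⟧) (split u) ≡ label (step s (intro c)) u
  lab-split zero    = refl
  lab-split (suc u) = refl
  edge-split : ∀ u v → edge (vertexᴸ c ⊕ ⟦ s ⟧) (split u) (split v) ≡ adj (step s (intro c)) u v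
  edge-split zero    zero    = refl
  edge-split zero    (suc v) = refl
  edge-split (suc u) zero    = refl
  edge-split (suc u) (suc v) = refl
⟦step⟧ s (join _ _ _)    = ≅-refl
⟦step⟧ s (relabel _ _ _) = ≅-refl

⊕-cong : {X X′ Y Y′ : LabelledGraph k} → X ≅ X′ → Y ≅ Y′ → X ⊕ Y ≅ X′ ⊕ Y′
⊕-cong (mk≅ φ lab-φ edge-φ) (mk≅ χ lab-χ edge-χ) = mk≅ (φ ⊎-↔ χ) lab edge′
  where
  lab : ∀ a → _
  lab (inj₁ a) = lab-φ a
  lab (inj₂ b) = lab-χ b
  edge′ : ∀ a b → _
  edge′ (inj₁ a) (inj₁ a′) = edge-φ a a′
  edge′ (inj₂ b) (inj₂ b′) = edge-χ b b′
  edge′ (inj₁ _) (inj₂ _)  = refl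
  edge′ (inj₂ _) (inj₁ _)  = refl

mapLabels-cong : (f : Fin k → Fin k′) {X Y : LabelledGraph k} → X ≅ Y →
                 mapLabels f X ≅ mapLabels f Y
mapLabels-cong f (mk≅ φ lab-φ edge-φ) = mk≅ φ (cong f ∘ lab-φ) edge-φ

joinᴸ-cong : (i j : Fin k) {X Y : LabelledGraph k} → X ≅ Y → joinᴸ i j X ≅ joinᴸ i j Y
joinᴸ-cong i j (mk≅ φ lab-φ edge-φ) = mk≅ φ lab-φ λ a b →
  cong₂ _∨_ (edge-φ a b)
    (cong₂ _∨_ (cong₂ _∧_ (cong (_== i) (lab-φ a)) (cong (_== j) (lab-φ b)))
               (cong₂ _∧_ (cong (_== j) (lab-φ a)) (cong (_== i) (lab-φ b))))

stepᴸ-cong : (o : Op k) {X Y : LabelledGraph k} → X ≅ Y → stepᴸ X o ≅ stepᴸ Y o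
stepᴸ-cong (intro c)       = ⊕-cong ≅-refl
stepᴸ-cong (join i j _)    = joinᴸ-cong i j
stepᴸ-cong (relabel i j _) = mapLabels-cong (relabelLabel i j)

⊕-emptyʳ : {X Y : LabelledGraph k} → ¬ Vertex Y → X ⊕ Y ≅ X
⊕-emptyʳ {X = X} {Y} ¬y = mk≅ (mk↔ₛ′ left inj₁ (λ _ → refl) inj₁-left) lab edge′
  where
  left : Vertex X ⊎ Vertex Y → Vertex X
  left = [ id , ⊥-elim ∘ ¬y ]
  inj₁-left : ∀ a → inj₁ (left a) ≡ a
  inj₁-left (inj₁ a) = refl
  inj₁-left (inj₂ b) = ⊥-elim (¬y b)
  lab : ∀ a → labelOf X (left a) ≡ labelOf (X ⊕ Y) a
  lab (inj₁ a) = refl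
  lab (inj₂ b) = ⊥-elim (¬y b)
  edge′ : ∀ a b → edge X (left a) (left b) ≡ edge (X ⊕ Y) a b
  edge′ (inj₁ a) (inj₁ b) = refl
  edge′ (inj₂ a) _        = ⊥-elim (¬y a)
  edge′ (inj₁ _) (inj₂ b) = ⊥-elim (¬y b)

⊕-comm : {X Y : LabelledGraph k} → X ⊕ Y ≅ Y ⊕ X
⊕-comm = mk≅ (⊎-comm _ _) lab edge′
  where
  lab : ∀ a → _
  lab (inj₁ _) = refl
  lab (inj₂ _) = refl
  edge′ : ∀ a b → _
  edge′ (inj₁ _) (inj₁ _) = refl
  edge′ (inj₁ _) (inj₂ _) = refl
  edge′ (inj₂ _) (inj₁ _) = refl
  edge′ (inj₂ _) (inj₂ _) = refl

⊕-emptyˡ : {X Y : LabelledGraph k} → ¬ Vertex X → X ⊕ Y ≅ Y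
⊕-emptyˡ ¬x = ≅-trans ⊕-comm (⊕-emptyʳ ¬x)

⊕-assoc : {X Y Z : LabelledGraph k} → (X ⊕ Y) ⊕ Z ≅ X ⊕ (Y ⊕ Z)
⊕-assoc = mk≅ (⊎-assoc 0ℓ _ _ _) lab edge′
  where
  lab : ∀ a → _
  lab (inj₁ (inj₁ _)) = refl
  lab (inj₁ (inj₂ _)) = refl
  lab (inj₂ _)        = refl
  edge′ : ∀ a b → _
  edge′ (inj₁ (inj₁ _)) (inj₁ (inj₁ _)) = refl
  edge′ (inj₁ (inj₁ _)) (inj₁ (inj₂ _)) = refl
  edge′ (inj₁ (inj₁ _)) (inj₂ _)        = refl
  edge′ (inj₁ (inj₂ _)) (inj₁ (inj₁ _)) = refl
  edge′ (inj₁ (inj₂ _)) (inj₁ (inj₂ _)) = refl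
  edge′ (inj₁ (inj₂ _)) (inj₂ _)        = refl
  edge′ (inj₂ _)        (inj₁ (inj₁ _)) = refl
  edge′ (inj₂ _)        (inj₁ (inj₂ _)) = refl
  edge′ (inj₂ _)        (inj₂ _)        = refl

mapLabels-⊕ : (f : Fin k → Fin k′) {X Y : LabelledGraph k} →
              mapLabels f (X ⊕ Y) ≅ mapLabels f X ⊕ mapLabels f Y
mapLabels-⊕ f = ≅-pointwise lab (λ _ _ → refl)
  where
  lab : ∀ a → _
  lab (inj₁ _) = refl
  lab (inj₂ _) = refl

==-refl : (a : Fin k) → (a == a) ≡ true
==-refl a with a ≟ a
... | yes _   = refl
... | no a≢a = ⊥-elim (a≢a refl)

==-≢ : {a b : Fin k} → ¬ a ≡ b → (a == b) ≡ false
==-≢ {a = a} {b} a≢b with a ≟ b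
... | yes a≡b = ⊥-elim (a≢b a≡b)
... | no _    = refl

==-injective : {g : Fin k → Fin k′} → Injective _≡_ _≡_ g → ∀ a b → (g a == g b) ≡ (a == b)
==-injective {g = g} g-inj a b with a ≟ b
... | yes refl = ==-refl (g a)
... | no a≢b   = ==-≢ (a≢b ∘ g-inj)

==-both : {i j : Fin k} → ¬ i ≡ j → (l : Fin k) → (l == i ∧ l == j) ≡ false
==-both {i = i} i≢j l with l ≟ i
... | yes refl = ==-≢ i≢j
... | no _     = refl

relabelLabel-target : (i j : Fin k) → relabelLabel i j j ≡ j
relabelLabel-target i j with j == i
... | true  = refl
... | false = refl

relabelLabel-source : (i j : Fin k) → relabelLabel i j i ≡ j
relabelLabel-source i j rewrite ==-refl i = refl

relabelLabel-self : (i l : Fin k) → relabelLabel i i l ≡ l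
relabelLabel-self i l with l ≟ i
... | yes refl = refl
... | no _     = refl

relabelLabel-other : {i l : Fin k} (j : Fin k) → ¬ l ≡ i → relabelLabel i j l ≡ l
relabelLabel-other j l≢i rewrite ==-≢ l≢i = refl

renameOp : (g : Fin k → Fin k′) → Injective _≡_ _≡_ g → Op k → Op k′
renameOp g g-inj (intro c)         = intro (g c)
renameOp g g-inj (join i j i≢j)    = join (g i) (g j) (i≢j ∘ g-inj)
renameOp g g-inj (relabel i j i≢j) = relabel (g i) (g j) (i≢j ∘ g-inj)

mapLabels-step : (g : Fin k → Fin k′) (g-inj : Injective _≡_ _≡_ g) {X : LabelledGraph k} (o : Op k) →
                 mapLabels g (stepᴸ X o) ≅ stepᴸ (mapLabels g X) (renameOp g g-inj o)
mapLabels-step g g-inj (intro c) = ≅-pointwise lab (λ _ _ → refl)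
  where
  lab : ∀ a → _
  lab (inj₁ _) = refl
  lab (inj₂ _) = refl
mapLabels-step g g-inj {X} (join i j _) = ≅-pointwise (λ _ → refl) λ a b →
  cong (edge X a b ∨_) (cong₂ _∨_
    (cong₂ _∧_ (==-injective g-inj (labelOf X a) i) (==-injective g-inj (labelOf X b) j))
    (cong₂ _∧_ (==-injective g-inj (labelOf X a) j) (==-injective g-inj (labelOf X b) i)))
mapLabels-step g g-inj {X} (relabel i j _) = ≅-pointwise lab (λ _ _ → refl)
  where
  lab : ∀ a → relabelLabel (g i) (g j) (g (labelOf X a)) ≡ g (relabelLabel i j (labelOf X a))
  lab a rewrite ==-injective g-inj (labelOf X a) i with labelOf X a == i
  ... | true  = refl
  ... | false = refl

stepᴸ-⊕ : (g : Fin k → Fin k′) (g-inj : Injective _≡_ _≡_ g) {X Y : LabelledGraph k′} →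
          (∀ a l → ¬ labelOf X a ≡ g l) → (o : Op k) →
          stepᴸ (X ⊕ Y) (renameOp g g-inj o) ≅ X ⊕ stepᴸ Y (renameOp g g-inj o)
stepᴸ-⊕ g g-inj {X} {Y} fresh (intro c) = begin
  vertexᴸ (g c) ⊕ (X ⊕ Y)   ≈⟨ ⊕-assoc ⟨
  (vertexᴸ (g c) ⊕ X) ⊕ Y   ≈⟨ ⊕-cong ⊕-comm ≅-refl ⟩
  (X ⊕ vertexᴸ (g c)) ⊕ Y   ≈⟨ ⊕-assoc ⟩
  X ⊕ (vertexᴸ (g c) ⊕ Y)   ∎
  where open ≅-Reasoning
stepᴸ-⊕ g g-inj {X} {Y} fresh (join i j _) = ≅-pointwise lab edge′
  where
  lab : ∀ a → _
  lab (inj₁ _) = refl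
  lab (inj₂ _) = refl
  untouched : ∀ a l → (labelOf X a == g l) ≡ false
  untouched a l = ==-≢ (fresh a l)
  edge′ : ∀ a b → _
  edge′ (inj₁ a) (inj₁ b) rewrite untouched a i | untouched a j = sym (∨-identityʳ _)
  edge′ (inj₁ a) (inj₂ b) rewrite untouched a i | untouched a j = refl
  edge′ (inj₂ a) (inj₁ b) rewrite untouched b i | untouched b j
    | ∧-zeroʳ (labelOf Y a == g i) | ∧-zeroʳ (labelOf Y a == g j) = refl
  edge′ (inj₂ a) (inj₂ b) = refl
stepᴸ-⊕ g g-inj {X} fresh (relabel i j _) = ≅-pointwise lab (λ _ _ → refl)
  where
  lab : ∀ a → _
  lab (inj₁ a) rewrite ==-≢ (fresh a i) = refl
  lab (inj₂ _) = refl

-- Running expressions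

-- Operations are listed latest first, so that structural recursion peels off the last one;
-- run≡build relates this to run.
buildFrom : LGraph k → List (Op k) → LGraph k
buildFrom = foldr λ o s → step s o

build : List (Op k) → LGraph k
build = buildFrom emptyLG

buildFrom-++ : (s : LGraph k) (xs ys : List (Op k)) →
               buildFrom s (xs ++ ys) ≡ buildFrom (buildFrom s ys) xs
buildFrom-++ s = foldr-++ _ s

build-rename : (g : Fin k → Fin k′) (g-inj : Injective _≡_ _≡_ g)
               {t : LGraph k′} {X : LabelledGraph k′} → ⟦ t ⟧ ≅ X →
               (∀ a l → ¬ labelOf X a ≡ g l) → (rs : List (Op k)) →
               ⟦ buildFrom t (map (renameOp g g-inj) rs) ⟧ ≅ X ⊕ mapLabels g ⟦ build rs ⟧
build-rename g g-inj t≅X fresh [] = ≅-trans t≅X (≅-sym (⊕-emptyʳ λ ()))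
build-rename g g-inj {t} {X} t≅X fresh (o ∷ rs) = begin
  ⟦ step R (rename o) ⟧                    ≈⟨ ⟦step⟧ R (rename o) ⟩
  stepᴸ ⟦ R ⟧ (rename o)                   ≈⟨ stepᴸ-cong (rename o) (build-rename g g-inj t≅X fresh rs) ⟩
  stepᴸ (X ⊕ mapLabels g ⟦ S ⟧) (rename o) ≈⟨ stepᴸ-⊕ g g-inj fresh o ⟩
  X ⊕ stepᴸ (mapLabels g ⟦ S ⟧) (rename o) ≈⟨ ⊕-cong ≅-refl (mapLabels-step g g-inj o) ⟨
  X ⊕ mapLabels g (stepᴸ ⟦ S ⟧ o)          ≈⟨ ⊕-cong ≅-refl (mapLabels-cong g (⟦step⟧ S o)) ⟨
  X ⊕ mapLabels g ⟦ step S o ⟧             ∎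
  where
  open ≅-Reasoning
  rename = renameOp g g-inj
  R = buildFrom t (map rename rs)
  S = build rs

moveTo : Fin k → List (Fin k) → Fin k → Fin k
moveTo t = foldr (λ j f → relabelLabel j t ∘ f) id

relabelAllTo : Fin k → List (Fin k) → List (Op k)
relabelAllTo t [] = []
relabelAllTo t (j ∷ L) with j ≟ t
... | yes _   = relabelAllTo t L
... | no j≢t = relabel j t j≢t ∷ relabelAllTo t L

build-relabelAllTo : (s : LGraph k) (t : Fin k) (L : List (Fin k)) →
                     ⟦ buildFrom s (relabelAllTo t L) ⟧ ≅ mapLabels (moveTo t L) ⟦ s ⟧
build-relabelAllTo s t [] = ≅-refl
build-relabelAllTo s t (j ∷ L) with j ≟ t
... | yes refl = ≅-trans (build-relabelAllTo s t L)
                   (≅-pointwise (λ a → relabelLabel-self t (moveTo t L (label s a))) (λ _ _ → refl))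
... | no _     = mapLabels-cong (relabelLabel j t) (build-relabelAllTo s t L)

moveTo-∉ : {t l : Fin k} (L : List (Fin k)) → ¬ l ∈ L → moveTo t L l ≡ l
moveTo-∉ [] _ = refl
moveTo-∉ {t = t} {l} (j ∷ L) l∉L rewrite moveTo-∉ {t = t} L (l∉L ∘ there) =
  relabelLabel-other t (l∉L ∘ here)

moveTo-moves-or-fixes : (t l : Fin k) (L : List (Fin k)) → moveTo t L l ≡ t ⊎ moveTo t L l ≡ l
moveTo-moves-or-fixes t l [] = inj₂ refl
moveTo-moves-or-fixes t l (j ∷ L) with moveTo t L l == j
... | true  = inj₁ refl
... | false = moveTo-moves-or-fixes t l L

moveTo-∈ : {t l : Fin k} (L : List (Fin k)) → l ∈ L → moveTo t L l ≡ t
moveTo-∈ {t = t} {l} (l ∷ L) (here refl) with moveTo-moves-or-fixes t l L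
... | inj₁ moved rewrite moved = relabelLabel-target l t
... | inj₂ fixed rewrite fixed = relabelLabel-source l t
moveTo-∈ {t = t} (j ∷ L) (there l∈L) rewrite moveTo-∈ {t = t} L l∈L = relabelLabel-target j t

-- Linear constructibility

-- IsoTo s G is ⟦ s ⟧ ≃ᴳ G by definition.
_≃ᴳ_ : LabelledGraph k → Graph → Set
X ≃ᴳ G = Σ (Vertex X ↔ Fin (n G)) λ φ → ∀ a b → edge X a b ≡ Adj G (to φ a) (to φ b)

infix 4 _≃ᴳ_

≅-≃ᴳ : {X Y : LabelledGraph k} {G : Graph} → X ≅ Y → Y ≃ᴳ G → X ≃ᴳ G
≅-≃ᴳ (mk≅ φ _ edge-φ) (χ , edge-χ) =
  ↔-trans φ χ , λ a b → trans (sym (edge-φ a b)) (edge-χ (to φ a) (to φ b))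

monochrome-≃ᴳ : (c : Fin k′) {X : LabelledGraph k} {G : Graph} → X ≃ᴳ G →
                mapLabels (const c) X ≅ monochrome c G
monochrome-≃ᴳ c (φ , edge-φ) = mk≅ φ (λ _ → refl) (λ a b → sym (edge-φ a b))

run≡build : (ops : List (Op k)) → run ops ≡ build (reverse ops)
run≡build ops = sym (reverse-foldr _ emptyLG ops)

LinConstructible⇒build : (G : Graph) → LinConstructible k G →
                         Σ (List (Op k)) λ rs → ⟦ build rs ⟧ ≃ᴳ G
LinConstructible⇒build G (ops , iso) = reverse ops , subst (λ s → ⟦ s ⟧ ≃ᴳ G) (run≡build ops) iso

build⇒LinConstructible : (G : Graph) (rs : List (Op k)) → ⟦ build rs ⟧ ≃ᴳ G → LinConstructible k G
build⇒LinConstructible G rs iso = reverse rs , subst (λ s → ⟦ s ⟧ ≃ᴳ G) build≡run iso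
  where
  build≡run : build rs ≡ run (reverse rs)
  build≡run = sym (trans (run≡build (reverse rs)) (cong build (reverse-involutive rs)))

LinConstructible-mono : (G : Graph) → k ≤ k′ → LinConstructible k G → LinConstructible k′ G
LinConstructible-mono G k≤k′ c with LinConstructible⇒build G c
... | rs , rs≃G = build⇒LinConstructible G (map (renameOp widen widen-injective) rs)
  (≅-≃ᴳ {G = G} (≅-trans (build-rename widen widen-injective ≅-refl (λ ()) rs) (⊕-emptyˡ λ ())) rs≃G)
  where
  widen = λ i → inject≤ i k≤k′
  widen-injective : Injective _≡_ _≡_ widen
  widen-injective = inject≤-injective k≤k′ k≤k′ _ _

-- Induced subgraphs

induced : (X : LabelledGraph k) → (Vertex X → Bool) → LabelledGraph k
induced X P =
  labelled (Σ (Vertex X) (T ∘ P)) (labelOf X ∘ proj₁) λ a b → edge X (proj₁ a) (proj₁ b)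

≡-induced : {A : Set} {P : A → Bool} {a a′ : A} → a ≡ a′ → (p : T (P a)) (p′ : T (P a′)) →
            _≡_ {A = Σ A (T ∘ P)} (a , p) (a′ , p′)
≡-induced refl p p′ = cong (_ ,_) (T-irrelevant p p′)

induced-all : {X : LabelledGraph k} {P : Vertex X → Bool} → (∀ a → T (P a)) → induced X P ≅ X
induced-all all = mk≅ (mk↔ₛ′ proj₁ (λ a → a , all a) (λ _ → refl) λ (a , p) → ≡-induced refl (all a) p)
  (λ _ → refl) (λ _ _ → refl)

induced-intro-kept : (s : LGraph k) (c : Fin k) (P : Fin (suc (m s)) → Bool) → T (P zero) →
                     vertexᴸ c ⊕ induced ⟦ s ⟧ (P ∘ suc) ≅ induced ⟦ step s (intro c) ⟧ P
induced-intro-kept s c P p = mk≅ (mk↔ₛ′ f f⁻¹ f-f⁻¹ f⁻¹-f) lab edge′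
  where
  f : ⊤ ⊎ Σ (Fin (m s)) (T ∘ P ∘ suc) → Σ (Fin (suc (m s))) (T ∘ P)
  f (inj₁ tt)      = zero , p
  f (inj₂ (u , q)) = suc u , q
  f⁻¹ : Σ (Fin (suc (m s))) (T ∘ P) → ⊤ ⊎ Σ (Fin (m s)) (T ∘ P ∘ suc)
  f⁻¹ (zero , _)  = inj₁ tt
  f⁻¹ (suc u , q) = inj₂ (u , q)
  f-f⁻¹ : ∀ a → f (f⁻¹ a) ≡ a
  f-f⁻¹ (zero , q)  = ≡-induced refl p q
  f-f⁻¹ (suc u , q) = refl
  f⁻¹-f : ∀ a → f⁻¹ (f a) ≡ a
  f⁻¹-f (inj₁ tt) = refl
  f⁻¹-f (inj₂ _)  = refl
  lab : ∀ a → _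
  lab (inj₁ tt) = refl
  lab (inj₂ _)  = refl
  edge′ : ∀ a b → _
  edge′ (inj₁ tt) (inj₁ tt) = refl
  edge′ (inj₁ tt) (inj₂ _)  = refl
  edge′ (inj₂ _)  (inj₁ tt) = refl
  edge′ (inj₂ _)  (inj₂ _)  = refl

induced-intro-dropped : (s : LGraph k) (c : Fin k) (P : Fin (suc (m s)) → Bool) → ¬ T (P zero) →
                        induced ⟦ s ⟧ (P ∘ suc) ≅ induced ⟦ step s (intro c) ⟧ P
induced-intro-dropped s c P ¬p = mk≅ (mk↔ₛ′ f f⁻¹ f-f⁻¹ (λ _ → refl)) (λ _ → refl) (λ _ _ → refl)
  where
  f : Σ (Fin (m s)) (T ∘ P ∘ suc) → Σ (Fin (suc (m s))) (T ∘ P)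
  f (u , q) = suc u , q
  f⁻¹ : Σ (Fin (suc (m s))) (T ∘ P) → Σ (Fin (m s)) (T ∘ P ∘ suc)
  f⁻¹ (zero , q)  = ⊥-elim (¬p q)
  f⁻¹ (suc u , q) = u , q
  f-f⁻¹ : ∀ a → f (f⁻¹ a) ≡ a
  f-f⁻¹ (zero , q)  = ⊥-elim (¬p q)
  f-f⁻¹ (suc u , q) = refl

keepIntros : (rs : List (Op k)) → (Fin (m (build rs)) → Bool) → List (Op k)
keepIntros [] P = []
keepIntros (intro c ∷ rs) P with P zero
... | true  = intro c ∷ keepIntros rs (P ∘ suc)
... | false = keepIntros rs (P ∘ suc)
keepIntros (o@(join _ _ _) ∷ rs)    P = o ∷ keepIntros rs P
keepIntros (o@(relabel _ _ _) ∷ rs) P = o ∷ keepIntros rs P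

build-keepIntros : (rs : List (Op k)) (P : Fin (m (build rs)) → Bool) →
                   ⟦ build (keepIntros rs P) ⟧ ≅ induced ⟦ build rs ⟧ P
build-keepIntros [] P = mk≅ (mk↔ₛ′ (λ ()) (λ ()) (λ ()) (λ ())) (λ ()) (λ ())
build-keepIntros (intro c ∷ rs) P with P zero in p
... | true  = begin
  ⟦ step (build (keepIntros rs (P ∘ suc))) (intro c) ⟧ ≈⟨ ⟦step⟧ _ (intro c) ⟩
  vertexᴸ c ⊕ ⟦ build (keepIntros rs (P ∘ suc)) ⟧
    ≈⟨ ⊕-cong ≅-refl (build-keepIntros rs (P ∘ suc)) ⟩
  vertexᴸ c ⊕ induced ⟦ build rs ⟧ (P ∘ suc)
    ≈⟨ induced-intro-kept (build rs) c P (subst T (sym p) tt) ⟩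
  induced ⟦ step (build rs) (intro c) ⟧ P              ∎
  where open ≅-Reasoning
... | false = ≅-trans (build-keepIntros rs (P ∘ suc)) (induced-intro-dropped (build rs) c P (subst T p))
build-keepIntros (o@(join _ _ _) ∷ rs) P =
  ≅-trans (⟦step⟧ (build (keepIntros rs P)) o) (stepᴸ-cong o (build-keepIntros rs P))
build-keepIntros (o@(relabel _ _ _) ∷ rs) P =
  ≅-trans (⟦step⟧ (build (keepIntros rs P)) o) (stepᴸ-cong o (build-keepIntros rs P))

record InducedEmbedding (G′ G : Graph) : Set where
  field
    embed           : Fin (n G′) → Fin (n G)
    embed-injective : Injective _≡_ _≡_ embed
    Adj-embed       : ∀ a b → Adj G (embed a) (embed b) ≡ Adj G′ a b

module _ {G′ G : Graph} (ι : InducedEmbedding G′ G) where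
  open InducedEmbedding ι

  inImage : Fin (n G) → Bool
  inImage v = ⌊ any? (λ a → embed a ≟ v) ⌋

  induced-≃ᴳ : {X : LabelledGraph k} ((φ , _) : X ≃ᴳ G) → induced X (inImage ∘ to φ) ≃ᴳ G′
  induced-≃ᴳ {X = X} (φ , edge-φ) = mk↔ₛ′ preimage restrict preimage-restrict restrict-preimage , edge′
    where
    preimage : Σ (Vertex X) (T ∘ inImage ∘ to φ) → Fin (n G′)
    preimage (_ , p) = proj₁ (toWitness p)
    preimage-embeds : (a : Σ (Vertex X) (T ∘ inImage ∘ to φ)) → embed (preimage a) ≡ to φ (proj₁ a)
    preimage-embeds (_ , p) = proj₂ (toWitness p)
    restrict : Fin (n G′) → Σ (Vertex X) (T ∘ inImage ∘ to φ)
    restrict a = from φ (embed a) , fromWitness (a , sym (strictlyInverseˡ φ (embed a)))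
    preimage-restrict : ∀ a → preimage (restrict a) ≡ a
    preimage-restrict a =
      embed-injective (trans (preimage-embeds (restrict a)) (strictlyInverseˡ φ (embed a)))
    restrict-preimage : ∀ x → restrict (preimage x) ≡ x
    restrict-preimage (x , p) =
      ≡-induced (trans (cong (from φ) (preimage-embeds (x , p))) (strictlyInverseʳ φ x)) _ p
    edge′ : ∀ x y → edge X (proj₁ x) (proj₁ y) ≡ Adj G′ (preimage x) (preimage y)
    edge′ x y = begin
      edge X (proj₁ x) (proj₁ y)                      ≡⟨ edge-φ (proj₁ x) (proj₁ y) ⟩
      Adj G (to φ (proj₁ x)) (to φ (proj₁ y))
        ≡⟨ cong₂ (Adj G) (preimage-embeds x) (preimage-embeds y) ⟨
      Adj G (embed (preimage x)) (embed (preimage y)) ≡⟨ Adj-embed (preimage x) (preimage y) ⟩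
      Adj G′ (preimage x) (preimage y)                ∎
      where open ≡-Reasoning

  LinConstructible-induced : LinConstructible k G → LinConstructible k G′
  LinConstructible-induced c with LinConstructible⇒build G c
  ... | rs , rs≃G = build⇒LinConstructible G′ (keepIntros rs (inImage ∘ to (proj₁ rs≃G)))
    (≅-≃ᴳ {G = G′} (build-keepIntros rs _) (induced-≃ᴳ {X = ⟦ build rs ⟧} rs≃G))

  Lcw-induced : {l l′ : ℕ} → Lcw G′ l′ → Lcw G l → l′ ≤ l
  Lcw-induced (_ , minimal) (c , _) = minimal _ (LinConstructible-induced c)

-- Inflations

inflEdge : {N : ℕ} → (Fin N → Fin N → Bool) → (Gs : Fin N → Graph) →
           Σ (Fin N) (Fin ∘ n ∘ Gs) → Σ (Fin N) (Fin ∘ n ∘ Gs) → Bool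
inflEdge E Gs (u , a) (w , b) with u ≟ w
... | yes refl = Adj (Gs u) a b
... | no _     = E u w

inflate : (s : LGraph k) → (Fin (m s) → Graph) → LabelledGraph k
inflate s Gs = labelled (Σ (Fin (m s)) (Fin ∘ n ∘ Gs)) (label s ∘ proj₁) (inflEdge (adj s) Gs)

inflate-intro : (s : LGraph k) (c : Fin k) (Gs : Fin (suc (m s)) → Graph) →
                inflate (step s (intro c)) Gs ≅ monochrome c (Gs zero) ⊕ inflate s (Gs ∘ suc)
inflate-intro s c Gs = mk≅ (mk↔ₛ′ split unsplit split-unsplit unsplit-split) lab edge′
  where
  split : Σ (Fin (suc (m s))) (Fin ∘ n ∘ Gs) → Fin (n (Gs zero)) ⊎ Σ (Fin (m s)) (Fin ∘ n ∘ Gs ∘ suc)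
  split (zero , a)  = inj₁ a
  split (suc u , a) = inj₂ (u , a)
  unsplit : Fin (n (Gs zero)) ⊎ Σ (Fin (m s)) (Fin ∘ n ∘ Gs ∘ suc) → Σ (Fin (suc (m s))) (Fin ∘ n ∘ Gs)
  unsplit (inj₁ a)       = zero , a
  unsplit (inj₂ (u , a)) = suc u , a
  split-unsplit : ∀ x → split (unsplit x) ≡ x
  split-unsplit (inj₁ _) = refl
  split-unsplit (inj₂ _) = refl
  unsplit-split : ∀ x → unsplit (split x) ≡ x
  unsplit-split (zero , _)  = refl
  unsplit-split (suc _ , _) = refl
  lab : ∀ x → _
  lab (zero , _)  = refl
  lab (suc _ , _) = refl
  edge′ : ∀ x y → _
  edge′ (zero , a)  (zero , b)  = refl
  edge′ (zero , a)  (suc w , b) = refl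
  edge′ (suc u , a) (zero , b)  = refl
  edge′ (suc u , a) (suc w , b) with u ≟ w
  ... | yes refl = refl
  ... | no _     = refl

inflate-join : (s : LGraph k) (i j : Fin k) (i≢j : ¬ i ≡ j) (Gs : Fin (m s) → Graph) →
               inflate (step s (join i j i≢j)) Gs ≅ joinᴸ i j (inflate s Gs)
inflate-join s i j i≢j Gs = ≅-pointwise (λ _ → refl) edge′
  where
  edge′ : ∀ x y → _
  edge′ (u , a) (w , b) with u ≟ w
  ... | yes refl rewrite ==-both i≢j (label s u) | ==-both (i≢j ∘ sym) (label s u) = ∨-identityʳ _
  ... | no _     = refl

inflEdge-reindex : {H : Graph} (Gs : Fin (n H) → Graph) {N : ℕ} {E : Fin N → Fin N → Bool}
                   (ψ : Fin N → Fin (n H)) →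
                   Injective _≡_ _≡_ ψ → (∀ u w → E u w ≡ Adj H (ψ u) (ψ w)) →
                   ∀ u a w b → inflEdge E (Gs ∘ ψ) (u , a) (w , b) ≡ inflAdj H Gs (ψ u , a) (ψ w , b)
inflEdge-reindex Gs ψ ψ-inj E≡Adj u a w b with u ≟ w | ψ u ≟ ψ w
... | yes refl | yes refl = refl
... | yes refl | no ψu≢ψu = ⊥-elim (ψu≢ψu refl)
... | no u≢w   | yes ψu≡ψw = ⊥-elim (u≢w (ψ-inj ψu≡ψw))
... | no _     | no _      = E≡Adj u w

inflate-≃ᴳ : {H G : Graph} {Gs : Fin (n H) → Graph} {s : LGraph k} ((φ , _) : ⟦ s ⟧ ≃ᴳ H) →
             IsInflation G H Gs → inflate s (Gs ∘ to φ) ≃ᴳ G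
inflate-≃ᴳ {H = H} {G} {Gs} (φ , adj-φ) (χ , Adj-χ) = ↔-trans (Σ-↔ φ ↔-refl) (↔-sym χ) , edge′
  where
  edge′ : ∀ x y → _
  edge′ (u , a) (w , b) = begin
    inflEdge _ (Gs ∘ to φ) (u , a) (w , b)
      ≡⟨ inflEdge-reindex Gs (to φ) (Injection.injective (↔⇒↣ φ)) adj-φ u a w b ⟩
    inflAdj H Gs (to φ u , a) (to φ w , b)
      ≡⟨ cong₂ (inflAdj H Gs) (strictlyInverseˡ χ _) (strictlyInverseˡ χ _) ⟨
    inflAdj H Gs (to χ (from χ (to φ u , a))) (to χ (from χ (to φ w , b))) ≡⟨ Adj-χ _ _ ⟨
    Adj G (from χ (to φ u , a)) (from χ (to φ w , b)) ∎
    where open ≡-Reasoning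

inflAdj-diag : (H : Graph) (Gs : Fin (n H) → Graph) (x : Fin (n H)) (a b : Fin (n (Gs x))) →
               inflAdj H Gs (x , a) (x , b) ≡ Adj (Gs x) a b
inflAdj-diag H Gs x a b with x ≟ x
... | yes refl = refl
... | no x≢x   = ⊥-elim (x≢x refl)

part-embedding : {H G : Graph} {Gs : Fin (n H) → Graph} → IsInflation G H Gs → (x : Fin (n H)) →
                 InducedEmbedding (Gs x) G
part-embedding {H} {G} {Gs} (φ , Adj-φ) x = record
  { embed           = λ a → from φ (x , a)
  ; embed-injective =
      ,-injectiveʳ-UIP (Decidable⇒UIP.≡-irrelevant _≟_) ∘ Injection.injective (↔⇒↣ (↔-sym φ))
  ; Adj-embed       = λ a b → begin
      Adj G (from φ (x , a)) (from φ (x , b))                         ≡⟨ Adj-φ _ _ ⟩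
      inflAdj H Gs (to φ (from φ (x , a))) (to φ (from φ (x , b)))
        ≡⟨ cong₂ (inflAdj H Gs) (strictlyInverseˡ φ _) (strictlyInverseˡ φ _) ⟩
      inflAdj H Gs (x , a) (x , b)                                   ≡⟨ inflAdj-diag H Gs x a b ⟩
      Adj (Gs x) a b                                                 ∎
  }
  where open ≡-Reasoning

-- Building an inflation

module InflationConstruction
  (H : Graph) (Gs : Fin (n H) → Graph) (x : Fin (n H)) (lH M : ℕ)
  (exprOf : ∀ v → ¬ v ≡ x → List (Op M))
  (exprOf-≃ᴳ : ∀ v v≢x → ⟦ build (exprOf v v≢x) ⟧ ≃ᴳ Gs v)
  (exprX : List (Op (suc (lH + M))))
  (exprX-≃ᴳ : ⟦ build exprX ⟧ ≃ᴳ Gs x)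
  where

  K : ℕ
  K = suc (lH + M)

  -- The label set splits into the label of the parked copy of G_x, a copy of the labels of H,
  -- and a private palette on which each other part G_v is built.
  waiting : Fin K
  waiting = zero

  hLabel : Fin lH → Fin K
  hLabel i = suc (i ↑ˡ M)

  gLabel : Fin M → Fin K
  gLabel j = suc (lH ↑ʳ j)

  gLabels : List (Fin K)
  gLabels = map gLabel (allFin M)

  hLabel-injective : Injective _≡_ _≡_ hLabel
  hLabel-injective = ↑ˡ-injective M _ _ ∘ suc-injective

  gLabel-injective : Injective _≡_ _≡_ gLabel
  gLabel-injective = ↑ʳ-injective lH _ _ ∘ suc-injective

  hLabel≢gLabel : ∀ i j → ¬ hLabel i ≡ gLabel j
  hLabel≢gLabel i j eq
    with trans (sym (splitAt-↑ˡ lH i M)) (trans (cong (splitAt lH) (suc-injective eq)) (splitAt-↑ʳ lH M j))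
  ... | ()

  x∉? : {N : ℕ} (ψ : Fin N → Fin (n H)) → Dec (∀ u → ¬ ψ u ≡ x)
  x∉? ψ = all? (λ u → ¬? (ψ u ≟ x))

  -- The copy of G_x stays parked under waiting, isolated, until x is introduced.
  waitingCopy : {N : ℕ} → (Fin N → Fin (n H)) → LabelledGraph K
  waitingCopy ψ = induced (monochrome waiting (Gs x)) (const ⌊ x∉? ψ ⌋)

  waitingCopy-full : {N : ℕ} (ψ : Fin N → Fin (n H)) → (∀ u → ¬ ψ u ≡ x) →
                     waitingCopy ψ ≅ monochrome waiting (Gs x)
  waitingCopy-full ψ x∉ψ = induced-all (λ _ → fromWitness x∉ψ)

  waitingCopy-empty : {N : ℕ} (ψ : Fin N → Fin (n H)) (u : Fin N) → ψ u ≡ x → ¬ Vertex (waitingCopy ψ)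
  waitingCopy-empty ψ u ψu≡x (_ , x∉ψ) = toWitness x∉ψ u ψu≡x

  waitingCopy-suc : {N : ℕ} (ψ : Fin (suc N) → Fin (n H)) → ¬ ψ zero ≡ x →
                    waitingCopy (ψ ∘ suc) ≅ waitingCopy ψ
  waitingCopy-suc ψ ψ₀≢x =
    ≅-reflexive (cong (λ b → induced (monochrome waiting (Gs x)) (const b)) same-answer)
    where
    extend : (∀ u → ¬ ψ (suc u) ≡ x) → ∀ u → ¬ ψ u ≡ x
    extend _ zero    = ψ₀≢x
    extend f (suc u) = f u
    same-answer : ⌊ x∉? (ψ ∘ suc) ⌋ ≡ ⌊ x∉? ψ ⌋
    same-answer = trans (isYes≗does (x∉? (ψ ∘ suc)))
      (trans (does-⇔ (mk⇔ extend (_∘ suc)) (x∉? (ψ ∘ suc)) (x∉? ψ)) (sym (isYes≗does (x∉? ψ))))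

  -- ψ identifies the vertices built so far by the expression for H with vertices of H.
  Target : (s : LGraph lH) → (Fin (m s) → Fin (n H)) → LabelledGraph K
  Target s ψ = waitingCopy ψ ⊕ mapLabels hLabel (inflate s (Gs ∘ ψ))

  Target-avoids-gLabel : (s : LGraph lH) (ψ : Fin (m s) → Fin (n H)) →
                         ∀ a j → ¬ labelOf (Target s ψ) a ≡ gLabel j
  Target-avoids-gLabel s ψ (inj₁ _)       j ()
  Target-avoids-gLabel s ψ (inj₂ (u , _)) j = hLabel≢gLabel (label s u) j

  introducePart : Fin lH → (v : Fin (n H)) → ¬ v ≡ x → List (Op K)
  introducePart c v v≢x =
    relabelAllTo (hLabel c) gLabels ++ map (renameOp gLabel gLabel-injective) (exprOf v v≢x)

  buildFrom-introducePart : (c : Fin lH) (v : Fin (n H)) (v≢x : ¬ v ≡ x)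
    {t : LGraph K} {X : LabelledGraph K} → ⟦ t ⟧ ≅ X → (∀ a j → ¬ labelOf X a ≡ gLabel j) →
    ⟦ buildFrom t (introducePart c v v≢x) ⟧ ≅ X ⊕ monochrome (hLabel c) (Gs v)
  buildFrom-introducePart c v v≢x {t} {X} t≅X X-avoids = begin
    ⟦ buildFrom t (relabelAllTo (hLabel c) gLabels ++ map rename E) ⟧
      ≡⟨ cong ⟦_⟧ (buildFrom-++ t (relabelAllTo (hLabel c) gLabels) (map rename E)) ⟩
    ⟦ buildFrom (buildFrom t (map rename E)) (relabelAllTo (hLabel c) gLabels) ⟧
      ≈⟨ build-relabelAllTo (buildFrom t (map rename E)) (hLabel c) gLabels ⟩
    mapLabels move ⟦ buildFrom t (map rename E) ⟧
      ≈⟨ mapLabels-cong move (build-rename gLabel gLabel-injective t≅X X-avoids E) ⟩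
    mapLabels move (X ⊕ mapLabels gLabel ⟦ build E ⟧)
      ≈⟨ mapLabels-⊕ move ⟩
    mapLabels move X ⊕ mapLabels move (mapLabels gLabel ⟦ build E ⟧)
      ≈⟨ ⊕-cong (≅-pointwise fixes (λ _ _ → refl)) (≅-pointwise moves (λ _ _ → refl)) ⟩
    X ⊕ mapLabels (const (hLabel c)) ⟦ build E ⟧
      ≈⟨ ⊕-cong ≅-refl (monochrome-≃ᴳ (hLabel c) {X = ⟦ build E ⟧} {G = Gs v} (exprOf-≃ᴳ v v≢x)) ⟩
    X ⊕ monochrome (hLabel c) (Gs v)
      ∎
    where
    open ≅-Reasoning
    E = exprOf v v≢x
    rename = renameOp gLabel gLabel-injective
    move = moveTo (hLabel c) gLabels
    fixes : ∀ a → labelOf X a ≡ move (labelOf X a)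
    fixes a = sym (moveTo-∉ gLabels λ l∈gLabels →
      let j , _ , l≡gj = ∈-map⁻ gLabel l∈gLabels in X-avoids a j l≡gj)
    moves : ∀ a → hLabel c ≡ move (gLabel (labelOf ⟦ build E ⟧ a))
    moves a = sym (moveTo-∈ gLabels (∈-map⁺ gLabel (∈-allFin _)))

  introduce : Fin lH → (v : Fin (n H)) → Dec (v ≡ x) → List (Op K)
  introduce c v (yes _)  = relabel waiting (hLabel c) (λ ()) ∷ []
  introduce c v (no v≢x) = introducePart c v v≢x

  translate : (rs : List (Op lH)) → (Fin (m (build rs)) → Fin (n H)) → List (Op K)
  translate [] ψ = relabelAllTo waiting (allFin K) ++ exprX
  translate (intro c ∷ rs) ψ = introduce c (ψ zero) (ψ zero ≟ x) ++ translate rs (ψ ∘ suc)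
  translate (o@(join _ _ _) ∷ rs)    ψ = renameOp hLabel hLabel-injective o ∷ translate rs ψ
  translate (o@(relabel _ _ _) ∷ rs) ψ = renameOp hLabel hLabel-injective o ∷ translate rs ψ

  translate-base : (ψ : Fin 0 → Fin (n H)) → ⟦ build (translate [] ψ) ⟧ ≅ Target emptyLG ψ
  translate-base ψ = begin
    ⟦ build (relabelAllTo waiting (allFin K) ++ exprX) ⟧
      ≡⟨ cong ⟦_⟧ (buildFrom-++ emptyLG (relabelAllTo waiting (allFin K)) exprX) ⟩
    ⟦ buildFrom (build exprX) (relabelAllTo waiting (allFin K)) ⟧
      ≈⟨ build-relabelAllTo (build exprX) waiting (allFin K) ⟩
    mapLabels (moveTo waiting (allFin K)) ⟦ build exprX ⟧
      ≈⟨ ≅-pointwise (λ _ → sym (moveTo-∈ (allFin K) (∈-allFin _))) (λ _ _ → refl) ⟩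
    mapLabels (const waiting) ⟦ build exprX ⟧
      ≈⟨ monochrome-≃ᴳ waiting {X = ⟦ build exprX ⟧} {G = Gs x} exprX-≃ᴳ ⟩
    monochrome waiting (Gs x)
      ≈⟨ waitingCopy-full ψ (λ ()) ⟨
    waitingCopy ψ
      ≈⟨ ⊕-emptyʳ (λ ()) ⟨
    Target emptyLG ψ
      ∎
    where open ≅-Reasoning

  translate-renamed : (rs : List (Op lH)) (ψ : Fin (m (build rs)) → Fin (n H)) (o : Op lH)
    {J : LabelledGraph lH} → J ≅ stepᴸ (inflate (build rs) (Gs ∘ ψ)) o →
    ⟦ build (translate rs ψ) ⟧ ≅ Target (build rs) ψ →
    ⟦ step (build (translate rs ψ)) (renameOp hLabel hLabel-injective o) ⟧ ≅
    waitingCopy ψ ⊕ mapLabels hLabel J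
  translate-renamed rs ψ o {J} inflate-step IH = begin
    ⟦ step R (rename o) ⟧
      ≈⟨ ⟦step⟧ R (rename o) ⟩
    stepᴸ ⟦ R ⟧ (rename o)
      ≈⟨ stepᴸ-cong (rename o) IH ⟩
    stepᴸ (waitingCopy ψ ⊕ mapLabels hLabel I) (rename o)
      ≈⟨ stepᴸ-⊕ hLabel hLabel-injective (λ _ _ ()) o ⟩
    waitingCopy ψ ⊕ stepᴸ (mapLabels hLabel I) (rename o)
      ≈⟨ ⊕-cong ≅-refl (mapLabels-step hLabel hLabel-injective o) ⟨
    waitingCopy ψ ⊕ mapLabels hLabel (stepᴸ I o)
      ≈⟨ ⊕-cong ≅-refl (mapLabels-cong hLabel inflate-step) ⟨
    waitingCopy ψ ⊕ mapLabels hLabel J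
      ∎
    where
    open ≅-Reasoning
    R = build (translate rs ψ)
    I = inflate (build rs) (Gs ∘ ψ)
    rename = renameOp hLabel hLabel-injective

  translate-intro-x : (rs : List (Op lH)) (c : Fin lH) (ψ : Fin (suc (m (build rs))) → Fin (n H)) →
    Injective _≡_ _≡_ ψ → ψ zero ≡ x →
    ⟦ build (translate rs (ψ ∘ suc)) ⟧ ≅ Target (build rs) (ψ ∘ suc) →
    ⟦ step (build (translate rs (ψ ∘ suc))) (relabel waiting (hLabel c) (λ ())) ⟧ ≅
    Target (step (build rs) (intro c)) ψ
  translate-intro-x rs c ψ ψ-inj ψ₀≡x IH = begin
    mapLabels move ⟦ build (translate rs (ψ ∘ suc)) ⟧
      ≈⟨ mapLabels-cong move IH ⟩
    mapLabels move (waitingCopy (ψ ∘ suc) ⊕ mapLabels hLabel I)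
      ≈⟨ mapLabels-⊕ move ⟩
    mapLabels move (waitingCopy (ψ ∘ suc)) ⊕ mapLabels move (mapLabels hLabel I)
      ≈⟨ ⊕-cong (mapLabels-cong move (waitingCopy-full (ψ ∘ suc) x∉ψ∘suc))
                (≅-pointwise fixes (λ _ _ → refl)) ⟩
    mapLabels move (monochrome waiting (Gs x)) ⊕ mapLabels hLabel I
      ≈⟨ ⊕-cong (≅-pointwise (λ _ → relabelLabel-source waiting (hLabel c)) (λ _ _ → refl)) ≅-refl ⟩
    monochrome (hLabel c) (Gs x) ⊕ mapLabels hLabel I
      ≡⟨ cong (λ v → monochrome (hLabel c) (Gs v) ⊕ mapLabels hLabel I) (sym ψ₀≡x) ⟩
    monochrome (hLabel c) (Gs (ψ zero)) ⊕ mapLabels hLabel I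
      ≈⟨ mapLabels-⊕ hLabel ⟨
    mapLabels hLabel (monochrome c (Gs (ψ zero)) ⊕ I)
      ≈⟨ mapLabels-cong hLabel (inflate-intro (build rs) c (Gs ∘ ψ)) ⟨
    mapLabels hLabel (inflate (step (build rs) (intro c)) (Gs ∘ ψ))
      ≈⟨ ⊕-emptyˡ (waitingCopy-empty ψ zero ψ₀≡x) ⟨
    Target (step (build rs) (intro c)) ψ
      ∎
    where
    open ≅-Reasoning
    move = relabelLabel waiting (hLabel c)
    I = inflate (build rs) (Gs ∘ ψ ∘ suc)
    fixes : ∀ a → labelOf (mapLabels hLabel I) a ≡ move (labelOf (mapLabels hLabel I) a)
    fixes _ = sym (relabelLabel-other {i = waiting} (hLabel c) λ ())
    x∉ψ∘suc : ∀ u → ¬ ψ (suc u) ≡ x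
    x∉ψ∘suc u ψsu≡x with ψ-inj (trans ψsu≡x (sym ψ₀≡x))
    ... | ()

  translate-intro-other : (rs : List (Op lH)) (c : Fin lH) (ψ : Fin (suc (m (build rs))) → Fin (n H)) →
    (ψ₀≢x : ¬ ψ zero ≡ x) →
    ⟦ build (translate rs (ψ ∘ suc)) ⟧ ≅ Target (build rs) (ψ ∘ suc) →
    ⟦ build (introducePart c (ψ zero) ψ₀≢x ++ translate rs (ψ ∘ suc)) ⟧ ≅
    Target (step (build rs) (intro c)) ψ
  translate-intro-other rs c ψ ψ₀≢x IH = begin
    ⟦ build (introducePart c (ψ zero) ψ₀≢x ++ R) ⟧
      ≡⟨ cong ⟦_⟧ (buildFrom-++ emptyLG (introducePart c (ψ zero) ψ₀≢x) R) ⟩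
    ⟦ buildFrom (build R) (introducePart c (ψ zero) ψ₀≢x) ⟧
      ≈⟨ buildFrom-introducePart c (ψ zero) ψ₀≢x IH (Target-avoids-gLabel (build rs) (ψ ∘ suc)) ⟩
    (waitingCopy (ψ ∘ suc) ⊕ mapLabels hLabel I) ⊕ monochrome (hLabel c) (Gs (ψ zero))
      ≈⟨ ⊕-assoc ⟩
    waitingCopy (ψ ∘ suc) ⊕ (mapLabels hLabel I ⊕ monochrome (hLabel c) (Gs (ψ zero)))
      ≈⟨ ⊕-cong (waitingCopy-suc ψ ψ₀≢x) ⊕-comm ⟩
    waitingCopy ψ ⊕ (monochrome (hLabel c) (Gs (ψ zero)) ⊕ mapLabels hLabel I)
      ≈⟨ ⊕-cong ≅-refl (mapLabels-⊕ hLabel) ⟨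
    waitingCopy ψ ⊕ mapLabels hLabel (monochrome c (Gs (ψ zero)) ⊕ I)
      ≈⟨ ⊕-cong ≅-refl (mapLabels-cong hLabel (inflate-intro (build rs) c (Gs ∘ ψ))) ⟨
    Target (step (build rs) (intro c)) ψ
      ∎
    where
    open ≅-Reasoning
    R = translate rs (ψ ∘ suc)
    I = inflate (build rs) (Gs ∘ ψ ∘ suc)

  translate-intro : (rs : List (Op lH)) (c : Fin lH) (ψ : Fin (suc (m (build rs))) → Fin (n H)) →
    Injective _≡_ _≡_ ψ → (ψ₀≟x : Dec (ψ zero ≡ x)) →
    ⟦ build (translate rs (ψ ∘ suc)) ⟧ ≅ Target (build rs) (ψ ∘ suc) →
    ⟦ build (introduce c (ψ zero) ψ₀≟x ++ translate rs (ψ ∘ suc)) ⟧ ≅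
    Target (step (build rs) (intro c)) ψ
  translate-intro rs c ψ ψ-inj (yes ψ₀≡x) = translate-intro-x rs c ψ ψ-inj ψ₀≡x
  translate-intro rs c ψ ψ-inj (no ψ₀≢x)  = translate-intro-other rs c ψ ψ₀≢x

  build-translate : (rs : List (Op lH)) (ψ : Fin (m (build rs)) → Fin (n H)) → Injective _≡_ _≡_ ψ →
                    ⟦ build (translate rs ψ) ⟧ ≅ Target (build rs) ψ
  build-translate [] ψ _ = translate-base ψ
  build-translate (intro c ∷ rs) ψ ψ-inj =
    translate-intro rs c ψ ψ-inj (ψ zero ≟ x) (build-translate rs (ψ ∘ suc) (suc-injective ∘ ψ-inj))
  build-translate (o@(join i j i≢j) ∷ rs) ψ ψ-inj =
    translate-renamed rs ψ o (inflate-join (build rs) i j i≢j (Gs ∘ ψ)) (build-translate rs ψ ψ-inj)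
  build-translate (o@(relabel _ _ _) ∷ rs) ψ ψ-inj =
    translate-renamed rs ψ o ≅-refl (build-translate rs ψ ψ-inj)

  build-translate-≃ᴳ : {G : Graph} (rs : List (Op lH)) ((φ , _) : ⟦ build rs ⟧ ≃ᴳ H) →
                       IsInflation G H Gs → ⟦ build (translate rs (to φ)) ⟧ ≃ᴳ G
  build-translate-≃ᴳ {G} rs (φ , adj-φ) inflation = ≅-≃ᴳ {G = G}
    (≅-trans (build-translate rs (to φ) (Injection.injective (↔⇒↣ φ)))
             (⊕-emptyˡ (waitingCopy-empty (to φ) (from φ x) (strictlyInverseˡ φ x))))
    (inflate-≃ᴳ {H = H} {G} {Gs} {s = build rs} (φ , adj-φ) inflation)

LinConstructible-inflation : {H G : Graph} {Gs : Fin (n H) → Graph} → IsInflation G H Gs →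
  {lH M : ℕ} → LinConstructible lH H → (x : Fin (n H)) → LinConstructible (suc (lH + M)) (Gs x) →
  (∀ v → ¬ v ≡ x → LinConstructible M (Gs v)) → LinConstructible (suc (lH + M)) G
LinConstructible-inflation {H} {G} {Gs} inflation {lH} {M} cH x cX cV =
  build⇒LinConstructible G (translate rsH (to (proj₁ rsH≃H)))
    (build-translate-≃ᴳ {G = G} rsH rsH≃H inflation)
  where
  exprOf = λ v v≢x → LinConstructible⇒build (Gs v) (cV v v≢x)
  exprX = LinConstructible⇒build (Gs x) cX
  rsH = proj₁ (LinConstructible⇒build H cH)
  rsH≃H = proj₂ (LinConstructible⇒build H cH)
  open InflationConstruction H Gs x lH M
    (λ v v≢x → proj₁ (exprOf v v≢x)) (λ v v≢x → proj₂ (exprOf v v≢x)) (proj₁ exprX) (proj₂ exprX)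

m+n+1<1+o⇒m+[1+n]≤o : (m n o : ℕ) → m + n + 1 < suc o → m + suc n ≤ o
m+n+1<1+o⇒m+[1+n]≤o m n o lt = subst (_≤ o) (trans (+-comm (m + n) 1) (sym (+-suc m n))) (s≤s⁻¹ lt)

lcw-attained : {H G : Graph} {Gs : Fin (n H) → Graph} → IsInflation G H Gs →
  {lH lG : ℕ} {l : Fin (n H) → ℕ} → LinConstructible lH H → Lcw G lG → (∀ v → Lcw (Gs v) (l v)) →
  (x v₀ : Fin (n H)) → ¬ v₀ ≡ x → (∀ v → ¬ v ≡ x → l v + lH + 1 < lG) → l x ≡ lG
lcw-attained inflation {lG = zero} cH lcwG lcw x v₀ v₀≢x small = ⊥-elim (n≮0 (small v₀ v₀≢x))
lcw-attained {G = G} {Gs} inflation {lH} {suc K} {l} cH (cG , minimal) lcw x v₀ v₀≢x small =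
  ≤-antisym (Lcw-induced (part-embedding {G = G} {Gs} inflation x) (lcw x) (cG , minimal))
            (≮⇒≥ too-few-labels)
  where
  fits : ∀ v → ¬ v ≡ x → l v + suc lH ≤ K
  fits v v≢x = m+n+1<1+o⇒m+[1+n]≤o (l v) lH K (small v v≢x)
  -- the palette left in K labels beside waiting and the labels of H
  M = K ∸ suc lH
  1+lH+M≡K : suc (lH + M) ≡ K
  1+lH+M≡K = m+[n∸m]≡n (m+n≤o⇒n≤o (l v₀) (fits v₀ v₀≢x))
  too-few-labels : ¬ l x < suc K
  too-few-labels lx<lG = 1+n≰n (minimal K (subst (λ k → LinConstructible k G) 1+lH+M≡K
    (LinConstructible-inflation {G = G} {Gs} inflation cH x
      (LinConstructible-mono (Gs x) (subst (l x ≤_) (sym 1+lH+M≡K) (s≤s⁻¹ lx<lG)) (proj₁ (lcw x)))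
      λ v v≢x → LinConstructible-mono (Gs v) (m+n≤o⇒m≤o∸n (l v) (fits v v≢x)) (proj₁ (lcw v)))))

another-vertex : {N : ℕ} → 2 ≤ N → (x : Fin N) → Σ (Fin N) λ v → ¬ v ≡ x
another-vertex {suc (suc _)} (s≤s (s≤s _)) x = punchIn x zero , punchInᵢ≢i x zero

proposition3p5 : (H : Graph) (Gs : Fin (n H) → Graph) (G : Graph) →
    2 ≤ n H →
    (∀ v → 1 ≤ n (Gs v)) →
    IsInflation G H Gs →
    (lH lG : ℕ) (l : Fin (n H) → ℕ) →
    Lcw H lH → Lcw G lG → (∀ v → Lcw (Gs v) (l v)) →
    Σ (Fin (n H)) (λ x → l x ≡ lG)
    ⊎ Σ (Fin (n H)) (λ x → Σ (Fin (n H)) (λ y →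
        ¬ (x ≡ y) × (lG ≤ l x + lH + 1) × (lG ≤ l y + lH + 1)))
-- The parts need not be nonempty for this argument.
proposition3p5 H Gs G 2≤n _ inflation lH lG l (cH , _) lcwG lcw with any? (λ x → l x ≟ₙ lG)
... | yes attained = inj₁ attained
... | no unattained =
  let y , _ , large-y   = large-partner (fromℕ< 2≤n)
      z , y≢z , large-z = large-partner y
  in inj₂ (y , z , y≢z , large-y , large-z)
  where
  large-partner : ∀ x → Σ (Fin (n H)) λ y → ¬ x ≡ y × lG ≤ l y + lH + 1
  large-partner x with any? (λ y → ¬? (x ≟ y) ×-dec (lG ≤? l y + lH + 1))
  ... | yes found = found
  ... | no none   =
    let v₀ , v₀≢x = another-vertex 2≤n x
    in ⊥-elim (unattained (x , lcw-attained {G = G} {Gs} inflation cH lcwG lcw x v₀ v₀≢x small))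
    where
    small : ∀ v → ¬ v ≡ x → l v + lH + 1 < lG
    small v v≢x = ≰⇒> λ large → none (v , v≢x ∘ sym , large)
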